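{- The sequent calculus $\mathbf{LJ}$, viewed as a proof system for $\mathsf{IPC}$, has monotone feasible $\mathrm{PDIP}$: there is a polynomial $p$ such that for any $\mathbf{LJ}$-proof $u$ of an implication $\phi\to\psi\vee\theta$ with $\phi$ monotone, with code $w$, there are monotone circuits $C$ and $D$ of size at most $p(|u|,|w|)$ such that $([C],[D])$ is an $\mathsf{IPC}$-PDI for $\phi\to\psi\vee\theta$.
   Context: Formulas are over $\{\top,\bot,\wedge,\vee,\to\}$; monotone means containing no implication. $\mathbf{LJ}$ is Gentzen's intuitionistic sequent calculus with cut (the calculus $\mathbf{LK}$ restricted to sequents with at most one succedent formula); an $\mathbf{LJ}$-proof of a formula $\chi$ is a proof of $\Rightarrow\chi$. Monotone circuits have only $\top,\bot,\wedge,\vee$ gates; $[C]$ is the unfolded formula of $C$. An $\mathsf{IPC}$-PDI for $(\phi\to\psi\vee\theta)\in\mathsf{IPC}$ is a pair $(I,J)$ with atoms of $I,J$ among those of $\phi$ such that $\phi\to I\vee J$, $I\to\psi$, $J\to\theta$ are provable in $\mathsf{IPC}$. -}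

module Defs where

open import Data.Nat using (ℕ; zero; suc; _+_; _*_)
open import Data.Fin using (Fin)
open import Data.List using (List; []; _∷_; _++_)
open import Data.Maybe using (Maybe; just; nothing)
open import Data.Vec using (Vec; []; _∷ʳ_; lookup; last)
open import Data.Product using (_×_)
open import Data.Sum using (_⊎_)

infixr 6 _∧'_
infixr 5 _∨'_
infixr 4 _⇒'_

data Formula : Set where
  atom : ℕ → Formula
  ⊤'   : Formula
  ⊥'   : Formula
  _∧'_ : Formula → Formula → Formula
  _∨'_ : Formula → Formula → Formula
  _⇒'_ : Formula → Formula → Formula

data Monotone : Formula → Set where
  m-atom : ∀ n → Monotone (atom n)
  m-⊤    : Monotone ⊤'
  m-⊥    : Monotone ⊥'
  m-∧    : ∀ {A B} → Monotone A → Monotone B → Monotone (A ∧' B)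
  m-∨    : ∀ {A B} → Monotone A → Monotone B → Monotone (A ∨' B)

data Occurs (n : ℕ) : Formula → Set where
  o-atom : Occurs n (atom n)
  o-∧l : ∀ {A B} → Occurs n A → Occurs n (A ∧' B)
  o-∧r : ∀ {A B} → Occurs n B → Occurs n (A ∧' B)
  o-∨l : ∀ {A B} → Occurs n A → Occurs n (A ∨' B)
  o-∨r : ∀ {A B} → Occurs n B → Occurs n (A ∨' B)
  o-⇒l : ∀ {A B} → Occurs n A → Occurs n (A ⇒' B)
  o-⇒r : ∀ {A B} → Occurs n B → Occurs n (A ⇒' B)

fsize : Formula → ℕ
fsize (atom _) = 1
fsize ⊤' = 1
fsize ⊥' = 1
fsize (A ∧' B) = suc (fsize A + fsize B)
fsize (A ∨' B) = suc (fsize A + fsize B)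
fsize (A ⇒' B) = suc (fsize A + fsize B)

data LJ : List Formula → Maybe Formula → Set where
  ax    : ∀ A → LJ (A ∷ []) (just A)
  ax-⊤  : LJ [] (just ⊤')
  ax-⊥  : LJ (⊥' ∷ []) nothing
  wL    : ∀ {Γ Δ} A → LJ Γ Δ → LJ (A ∷ Γ) Δ
  wR    : ∀ {Γ} A → LJ Γ nothing → LJ Γ (just A)
  cL    : ∀ {Γ Δ A} → LJ (A ∷ A ∷ Γ) Δ → LJ (A ∷ Γ) Δ
  exL   : ∀ {Γ Π Δ A B} → LJ (Γ ++ A ∷ B ∷ Π) Δ → LJ (Γ ++ B ∷ A ∷ Π) Δ
  cut   : ∀ {Γ Π Δ} A → LJ Γ (just A) → LJ (A ∷ Π) Δ → LJ (Γ ++ Π) Δ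
  ∧R    : ∀ {Γ A B} → LJ Γ (just A) → LJ Γ (just B) → LJ Γ (just (A ∧' B))
  ∧L₁   : ∀ {Γ Δ A} B → LJ (A ∷ Γ) Δ → LJ ((A ∧' B) ∷ Γ) Δ
  ∧L₂   : ∀ {Γ Δ B} A → LJ (B ∷ Γ) Δ → LJ ((A ∧' B) ∷ Γ) Δ
  ∨R₁   : ∀ {Γ A} B → LJ Γ (just A) → LJ Γ (just (A ∨' B))
  ∨R₂   : ∀ {Γ B} A → LJ Γ (just B) → LJ Γ (just (A ∨' B))
  ∨L    : ∀ {Γ Δ A B} → LJ (A ∷ Γ) Δ → LJ (B ∷ Γ) Δ → LJ ((A ∨' B) ∷ Γ) Δ
  ⇒R    : ∀ {Γ A B} → LJ (A ∷ Γ) (just B) → LJ Γ (just (A ⇒' B))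
  ⇒L    : ∀ {Γ Π Δ A B} → LJ Γ (just A) → LJ (B ∷ Π) Δ → LJ ((A ⇒' B) ∷ Γ ++ Π) Δ

LJProof : Formula → Set
LJProof χ = LJ [] (just χ)

IPC⊢ : Formula → Set
IPC⊢ χ = LJProof χ

sumF : List Formula → ℕ
sumF [] = 0
sumF (A ∷ Γ) = fsize A + sumF Γ

msize : Maybe Formula → ℕ
msize nothing = 0
msize (just A) = fsize A

-- symbols of the end-sequent (plus one for the arrow)
seqSize : List Formula → Maybe Formula → ℕ
seqSize Γ Δ = suc (sumF Γ + msize Δ)

steps : ∀ {Γ Δ} → LJ Γ Δ → ℕ
steps (ax _) = 1
steps ax-⊤ = 1
steps ax-⊥ = 1
steps (wL _ u) = suc (steps u)
steps (wR _ u) = suc (steps u)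
steps (cL u) = suc (steps u)
steps (exL u) = suc (steps u)
steps (cut _ u v) = suc (steps u + steps v)
steps (∧R u v) = suc (steps u + steps v)
steps (∧L₁ _ u) = suc (steps u)
steps (∧L₂ _ u) = suc (steps u)
steps (∨R₁ _ u) = suc (steps u)
steps (∨R₂ _ u) = suc (steps u)
steps (∨L u v) = suc (steps u + steps v)
steps (⇒R u) = suc (steps u)
steps (⇒L u v) = suc (steps u + steps v)

-- |w| : length of the code of the proof, measured as the total number of
-- symbols of all sequents occurring in the proof tree
codeLength : ∀ {Γ Δ} → LJ Γ Δ → ℕ
codeLength {Γ} {Δ} (ax _) = seqSize Γ Δ
codeLength {Γ} {Δ} ax-⊤ = seqSize Γ Δ
codeLength {Γ} {Δ} ax-⊥ = seqSize Γ Δ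
codeLength {Γ} {Δ} (wL _ u) = seqSize Γ Δ + codeLength u
codeLength {Γ} {Δ} (wR _ u) = seqSize Γ Δ + codeLength u
codeLength {Γ} {Δ} (cL u) = seqSize Γ Δ + codeLength u
codeLength {Γ} {Δ} (exL u) = seqSize Γ Δ + codeLength u
codeLength {Γ} {Δ} (cut _ u v) = seqSize Γ Δ + (codeLength u + codeLength v)
codeLength {Γ} {Δ} (∧R u v) = seqSize Γ Δ + (codeLength u + codeLength v)
codeLength {Γ} {Δ} (∧L₁ _ u) = seqSize Γ Δ + codeLength u
codeLength {Γ} {Δ} (∧L₂ _ u) = seqSize Γ Δ + codeLength u
codeLength {Γ} {Δ} (∨R₁ _ u) = seqSize Γ Δ + codeLength u
codeLength {Γ} {Δ} (∨R₂ _ u) = seqSize Γ Δ + codeLength u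
codeLength {Γ} {Δ} (∨L u v) = seqSize Γ Δ + (codeLength u + codeLength v)
codeLength {Γ} {Δ} (⇒R u) = seqSize Γ Δ + codeLength u
codeLength {Γ} {Δ} (⇒L u v) = seqSize Γ Δ + (codeLength u + codeLength v)

-- Monotone circuits as straight-line programs: the k-th gate may only
-- refer to the k earlier gates.  Size = number of gates; output = last gate.

data Gate (k : ℕ) : Set where
  input : ℕ → Gate k
  top   : Gate k
  bot   : Gate k
  and   : Fin k → Fin k → Gate k
  or    : Fin k → Fin k → Gate k

data Circuit : ℕ → Set where
  []  : Circuit 0
  _▷_ : ∀ {k} → Circuit k → Gate k → Circuit (suc k)

gateFormula : ∀ {k} → Vec Formula k → Gate k → Formula
gateFormula v (input n) = atom n
gateFormula v top = ⊤'
gateFormula v bot = ⊥'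
gateFormula v (and i j) = lookup v i ∧' lookup v j
gateFormula v (or i j) = lookup v i ∨' lookup v j

unfoldAll : ∀ {k} → Circuit k → Vec Formula k
unfoldAll [] = []
unfoldAll (c ▷ g) = unfoldAll c ∷ʳ gateFormula (unfoldAll c) g

⟦_⟧ : ∀ {k} → Circuit (suc k) → Formula
⟦ c ⟧ = last (unfoldAll c)

data Poly2 : Set where
  const : ℕ → Poly2
  varX  : Poly2
  varY  : Poly2
  _⊕_   : Poly2 → Poly2 → Poly2
  _⊗_   : Poly2 → Poly2 → Poly2

evalP : Poly2 → ℕ → ℕ → ℕ
evalP (const c) x y = c
evalP varX x y = x
evalP varY x y = y
evalP (p ⊕ q) x y = evalP p x y + evalP q x y
evalP (p ⊗ q) x y = evalP p x y * evalP q x y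

IsPDI : Formula → Formula → Formula → Formula → Formula → Set
IsPDI φ ψ θ I J =
  (∀ n → Occurs n I → Occurs n φ) ×
  (∀ n → Occurs n J → Occurs n φ) ×
  IPC⊢ (φ ⇒' I ∨' J) ×
  IPC⊢ (I ⇒' ψ) ×
  IPC⊢ (J ⇒' θ)

-- Let Σ consist of the subformulas of φ and the succedents of the sequents of u.  For a set S of
-- atoms, let D(S) be the least subset of Σ that contains ⊤ and the atoms of φ lying in S and is closed under
-- ∧- and ∨-introduction and under every sequent Γ ⇒ C of u (if Γ ⊆ D(S) then C ∈ D(S)).  Since Σ is finite,
-- D(S) is reached after |Σ| + 1 rounds of a monotone iteration, so "G ∈ D(S)" is computed by a monotone
-- circuit of polynomial size whose formula I_G entails G in IPC, each round being sound.  A slash relative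
-- to membership in D(S) is sound for LJ because D(S) follows the sequents of u; when S satisfies the monotone
-- formula φ, φ is slashed, hence so is ψ ∨ θ, so that ψ ∈ D(S) or θ ∈ D(S).  Thus every set of atoms
-- satisfying φ satisfies I_ψ ∨ I_θ, and for monotone φ this yields an IPC-proof of φ → I_ψ ∨ I_θ by
-- splitting φ into conjunctions of atoms.

module Submission where

open import Defs
open import Data.Bool using (Bool; true; false; T; _∧_; _∨_)
open import Data.Bool.Properties using (T-∧; T-∨; T-≡)
open import Data.Empty using (⊥-elim) renaming (⊥ to Empty)
open import Data.Fin using (Fin; zero; suc; inject₁; fromℕ)
import Data.Fin.Subset as Subset
open Subset using (Subset; ∣_∣)
import Data.Fin.Subset.Properties as Subsetₚ
open Subsetₚ using (⊆-antisym; p⊂q⇒∣p∣<∣q∣; ∣p∣≤n)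
open import Data.List using (List; []; _∷_; _++_; length; map; lookup)
open import Data.List.Membership.Propositional using (_∈_)
open import Data.List.Membership.Propositional.Properties using (∈-map⁺; ∈-++⁺ˡ; ∈-++⁺ʳ)
open import Data.List.Properties using (length-++; length-map)
open import Data.List.Relation.Binary.Subset.Propositional using (_⊆_)
open import Data.List.Relation.Unary.All as All using (All; []; _∷_)
open import Data.List.Relation.Unary.All.Properties using (++⁺; ++⁻)
import Data.List.Relation.Unary.Any as Any
open Any using (here; there)
open import Data.List.Relation.Unary.Any.Properties using (lookup-index)
open import Data.Maybe using (Maybe; just; nothing)
import Data.Nat as ℕ
open ℕ using (ℕ; zero; suc; _+_; _*_; _≤_; z≤n; s≤s)
open import Data.List.Membership.DecPropositional ℕ._≟_ using (_∈?_)
open import Data.Nat.Properties using (≤-refl; ≤-trans; ≤-reflexive; ≤-<-trans; ≤⇒≯; n≤1+n; m≤m+n; +-comm; +-assoc; +-suc; +-identityʳ; +-mono-≤; +-monoˡ-≤; *-mono-≤; *-monoˡ-≤; *-monoʳ-≤; *-distribʳ-+; module ≤-Reasoning)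
open import Data.Product using (Σ; Σ-syntax; ∃; _×_; _,_; proj₁; proj₂; uncurry)
open import Data.Sum using (_⊎_; inj₁; inj₂; [_,_])
import Data.Sum as Sum
open import Data.Unit using (tt)
import Data.Vec as Vec
open Vec using (Vec; []; _∷_; _∷ʳ_)
open import Data.Vec.Properties using (last-∷ʳ; lookup∘tabulate; lookup-replicate; []=⇒lookup; lookup⇒[]=)
open import Function using (_∘_; id; Equivalence)
open Equivalence using (to; from)
open import Relation.Binary.PropositionalEquality using (_≡_; refl; sym; trans; cong; cong₂; subst; _≗_; module ≡-Reasoning)
open import Relation.Nullary using (Dec; yes; no; isYes; ¬_)
open import Relation.Nullary.Decidable using (toWitness; fromWitness; map′; _×-dec_; _⊎-dec_)

infix 2 _⊢_
_⊢_ : Formula → Formula → Set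
A ⊢ B = LJ (A ∷ []) (just B)

infixr 9 _⨾_
_⨾_ : ∀ {A B C} → A ⊢ B → B ⊢ C → A ⊢ C
_⨾_ {B = B} p q = cut B p q

⊢-refl : ∀ {A} → A ⊢ A
⊢-refl {A} = ax A

ex-falso : ∀ {C} → ⊥' ⊢ C
ex-falso {C} = wR C ax-⊥

⊢⊤ : ∀ {A} → A ⊢ ⊤'
⊢⊤ {A} = wL A ax-⊤

∧-proj₁ : ∀ {A B} → A ∧' B ⊢ A
∧-proj₁ {A} {B} = ∧L₁ B (ax A)

∧-proj₂ : ∀ {A B} → A ∧' B ⊢ B
∧-proj₂ {A} {B} = ∧L₂ A (ax B)

∨-inj₁ : ∀ {A B} → A ⊢ A ∨' B
∨-inj₁ {A} {B} = ∨R₁ B (ax A)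

∨-inj₂ : ∀ {A B} → B ⊢ A ∨' B
∨-inj₂ {A} {B} = ∨R₂ A (ax B)

⇒-apply : ∀ {H A B} → H ⊢ A ⇒' B → H ⊢ A → H ⊢ B
⇒-apply {H} {A} {B} f a = cL (cut (A ⇒' B) f (⇒L {Γ = H ∷ []} {Π = []} a (ax B)))

⇒-curry : ∀ {H A B} → H ∧' A ⊢ B → H ⊢ A ⇒' B
⇒-curry {H} {A} p = ⇒R (cut (H ∧' A) (∧R (wL A (ax H)) (exL {Γ = []} {Π = []} (wL H (ax A)))) p)

∧-map : ∀ {A B C D} → A ⊢ B → C ⊢ D → A ∧' C ⊢ B ∧' D
∧-map p q = ∧R (∧-proj₁ ⨾ p) (∧-proj₂ ⨾ q)

∨-map : ∀ {A B C D} → A ⊢ B → C ⊢ D → A ∨' C ⊢ B ∨' D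
∨-map p q = ∨L (p ⨾ ∨-inj₁) (q ⨾ ∨-inj₂)

∧-swap : ∀ {A B} → A ∧' B ⊢ B ∧' A
∧-swap = ∧R ∧-proj₂ ∧-proj₁

∧-distribˡ-∨ : ∀ {H A B} → H ∧' (A ∨' B) ⊢ H ∧' A ∨' H ∧' B
∧-distribˡ-∨ = ⇒-apply (∧-proj₂ ⨾ ∨L (⇒-curry (∧-swap ⨾ ∨-inj₁)) (⇒-curry (∧-swap ⨾ ∨-inj₂))) ∧-proj₁

⋀ : List Formula → Formula
⋀ [] = ⊤'
⋀ (A ∷ Γ) = A ∧' ⋀ Γ

LJ⇒⋀⊢ : ∀ {Γ C} → LJ Γ (just C) → ⋀ Γ ⊢ C
LJ⇒⋀⊢ {[]} d = wL ⊤' d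
LJ⇒⋀⊢ {A ∷ Γ} d = ⇒-apply (∧-proj₂ ⨾ LJ⇒⋀⊢ (⇒R d)) ∧-proj₁

∈⇒⋀⊢ : ∀ {A Γ} → A ∈ Γ → ⋀ Γ ⊢ A
∈⇒⋀⊢ (here refl) = ∧-proj₁
∈⇒⋀⊢ (there A∈Γ) = ∧-proj₂ ⨾ ∈⇒⋀⊢ A∈Γ

infix 4 _≟_
_≟_ : (A B : Formula) → Dec (A ≡ B)
atom m ≟ atom n = map′ (cong atom) (λ { refl → refl }) (m ℕ.≟ n)
⊤' ≟ ⊤' = yes refl
⊥' ≟ ⊥' = yes refl
(A ∧' B) ≟ (C ∧' D) = map′ (uncurry (cong₂ _∧'_)) (λ { refl → refl , refl }) (A ≟ C ×-dec B ≟ D)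
(A ∨' B) ≟ (C ∨' D) = map′ (uncurry (cong₂ _∨'_)) (λ { refl → refl , refl }) (A ≟ C ×-dec B ≟ D)
(A ⇒' B) ≟ (C ⇒' D) = map′ (uncurry (cong₂ _⇒'_)) (λ { refl → refl , refl }) (A ≟ C ×-dec B ≟ D)
(atom _) ≟ ⊤' = no λ ()
(atom _) ≟ ⊥' = no λ ()
(atom _) ≟ (_ ∧' _) = no λ ()
(atom _) ≟ (_ ∨' _) = no λ ()
(atom _) ≟ (_ ⇒' _) = no λ ()
⊤' ≟ (atom _) = no λ ()
⊤' ≟ ⊥' = no λ ()
⊤' ≟ (_ ∧' _) = no λ ()
⊤' ≟ (_ ∨' _) = no λ ()
⊤' ≟ (_ ⇒' _) = no λ ()
⊥' ≟ (atom _) = no λ ()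
⊥' ≟ ⊤' = no λ ()
⊥' ≟ (_ ∧' _) = no λ ()
⊥' ≟ (_ ∨' _) = no λ ()
⊥' ≟ (_ ⇒' _) = no λ ()
(_ ∧' _) ≟ (atom _) = no λ ()
(_ ∧' _) ≟ ⊤' = no λ ()
(_ ∧' _) ≟ ⊥' = no λ ()
(_ ∧' _) ≟ (_ ∨' _) = no λ ()
(_ ∧' _) ≟ (_ ⇒' _) = no λ ()
(_ ∨' _) ≟ (atom _) = no λ ()
(_ ∨' _) ≟ ⊤' = no λ ()
(_ ∨' _) ≟ ⊥' = no λ ()
(_ ∨' _) ≟ (_ ∧' _) = no λ ()
(_ ∨' _) ≟ (_ ⇒' _) = no λ ()
(_ ⇒' _) ≟ (atom _) = no λ ()
(_ ⇒' _) ≟ ⊤' = no λ ()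
(_ ⇒' _) ≟ ⊥' = no λ ()
(_ ⇒' _) ≟ (_ ∧' _) = no λ ()
(_ ⇒' _) ≟ (_ ∨' _) = no λ ()

occurs? : ∀ p A → Dec (Occurs p A)
occurs? p (atom q) = map′ (λ { refl → o-atom }) (λ { o-atom → refl }) (p ℕ.≟ q)
occurs? p ⊤' = no λ ()
occurs? p ⊥' = no λ ()
occurs? p (A ∧' B) =
  map′ [ o-∧l , o-∧r ] (λ { (o-∧l o) → inj₁ o ; (o-∧r o) → inj₂ o }) (occurs? p A ⊎-dec occurs? p B)
occurs? p (A ∨' B) =
  map′ [ o-∨l , o-∨r ] (λ { (o-∨l o) → inj₁ o ; (o-∨r o) → inj₂ o }) (occurs? p A ⊎-dec occurs? p B)
occurs? p (A ⇒' B) =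
  map′ [ o-⇒l , o-⇒r ] (λ { (o-⇒l o) → inj₁ o ; (o-⇒r o) → inj₂ o }) (occurs? p A ⊎-dec occurs? p B)

-- Implications evaluate to false; only monotone formulas are ever evaluated.
eval : List ℕ → Formula → Bool
eval S (atom p) = isYes (p ∈? S)
eval S ⊤' = true
eval S ⊥' = false
eval S (A ∧' B) = eval S A ∧ eval S B
eval S (A ∨' B) = eval S A ∨ eval S B
eval S (A ⇒' B) = false

eval-atom⇒∈ : ∀ {p S} → T (eval S (atom p)) → p ∈ S
eval-atom⇒∈ {p} {S} = toWitness {a? = p ∈? S}

∈⇒eval-atom : ∀ {p S} → p ∈ S → T (eval S (atom p))
∈⇒eval-atom {p} {S} = fromWitness {a? = p ∈? S}

eval-mono : ∀ {S S'} → S ⊆ S' → ∀ A → T (eval S A) → T (eval S' A)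
eval-mono S⊆S' (atom p) h = ∈⇒eval-atom (S⊆S' (eval-atom⇒∈ h))
eval-mono S⊆S' ⊤' h = h
eval-mono S⊆S' (A ∧' B) h =
  let a , b = to T-∧ h in from T-∧ (eval-mono S⊆S' A a , eval-mono S⊆S' B b)
eval-mono S⊆S' (A ∨' B) h = from T-∨ (Sum.map (eval-mono S⊆S' A) (eval-mono S⊆S' B) (to T-∨ h))

⋀atoms : List ℕ → Formula
⋀atoms S = ⋀ (map atom S)

eval⇒⊢ : ∀ {S} A → T (eval S A) → ⋀atoms S ⊢ A
eval⇒⊢ (atom p) h = ∈⇒⋀⊢ (∈-map⁺ atom (eval-atom⇒∈ h))
eval⇒⊢ ⊤' _ = ⊢⊤
eval⇒⊢ (A ∧' B) h = let a , b = to T-∧ h in ∧R (eval⇒⊢ A a) (eval⇒⊢ B b)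
eval⇒⊢ (A ∨' B) h = [ (λ a → eval⇒⊢ A a ⨾ ∨-inj₁) , (λ b → eval⇒⊢ B b ⨾ ∨-inj₂) ] (to T-∨ h)

-- Distributing over the disjunctions of φ splits ⋀ S ∧ φ into conjunctions of atoms satisfying φ.
monotone-split : ∀ {φ G} → Monotone φ → ∀ S →
                 (∀ S' → S ⊆ S' → T (eval S' φ) → ⋀atoms S' ⊢ G) → ⋀atoms S ∧' φ ⊢ G
monotone-split (m-atom p) S k = ∧-swap ⨾ k (p ∷ S) there (∈⇒eval-atom (here refl))
monotone-split m-⊤ S k = ∧-proj₁ ⨾ k S id tt
monotone-split m-⊥ S k = ∧-proj₂ ⨾ ex-falso
monotone-split (m-∨ mA mB) S k =
  ∧-distribˡ-∨ ⨾ ∨L (monotone-split mA S λ S' S⊆S' a → k S' S⊆S' (from T-∨ (inj₁ a)))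
                    (monotone-split mB S λ S' S⊆S' b → k S' S⊆S' (from T-∨ (inj₂ b)))
monotone-split {G = G} (m-∧ {A} {B} mA mB) S k =
  ⇒-apply (∧-map ⊢-refl ∧-proj₁ ⨾ split-A) (∧-proj₂ ⨾ ∧-proj₂)
  where
  split-A : ⋀atoms S ∧' A ⊢ B ⇒' G
  split-A = monotone-split mA S λ S' S⊆S' a → ⇒-curry (monotone-split mB S' λ S'' S'⊆S'' b →
              k S'' (S'⊆S'' ∘ S⊆S') (from T-∧ (eval-mono S'⊆S'' A a , b)))

monotone-⊢ : ∀ {φ G} → Monotone φ → (∀ S → T (eval S φ) → ⋀atoms S ⊢ G) → φ ⊢ G
monotone-⊢ mφ k = ∧R ⊢⊤ ⊢-refl ⨾ monotone-split mφ [] λ S _ → k S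

Derivation : Set
Derivation = Σ[ Γ ∈ List Formula ] Σ[ C ∈ Formula ] LJ Γ (just C)

conclusion : Derivation → Formula
conclusion (_ , C , _) = C

root : ∀ {Γ Δ} → LJ Γ Δ → List Derivation
root {Γ} {just C} d = (Γ , C , d) ∷ []
root {Δ = nothing} d = []

mutual
  derivations : ∀ {Γ Δ} → LJ Γ Δ → List Derivation
  derivations d = root d ++ subderivations d

  subderivations : ∀ {Γ Δ} → LJ Γ Δ → List Derivation
  subderivations (ax _) = []
  subderivations ax-⊤ = []
  subderivations ax-⊥ = []
  subderivations (wL _ d) = derivations d
  subderivations (wR _ d) = derivations d
  subderivations (cL d) = derivations d
  subderivations (exL d) = derivations d
  subderivations (cut _ d e) = derivations d ++ derivations e
  subderivations (∧R d e) = derivations d ++ derivations e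
  subderivations (∧L₁ _ d) = derivations d
  subderivations (∧L₂ _ d) = derivations d
  subderivations (∨R₁ _ d) = derivations d
  subderivations (∨R₂ _ d) = derivations d
  subderivations (∨L d e) = derivations d ++ derivations e
  subderivations (⇒R d) = derivations d
  subderivations (⇒L d e) = derivations d ++ derivations e

-- Kleene's slash, with provability replaced by an arbitrary predicate P.
module Slash (P : Formula → Set) where

  Slash : Formula → Set
  Slash (atom p) = P (atom p)
  Slash ⊤' = P ⊤'
  Slash ⊥' = Empty
  Slash (A ∧' B) = P (A ∧' B) × Slash A × Slash B
  Slash (A ∨' B) = P (A ∨' B) × (Slash A ⊎ Slash B)
  Slash (A ⇒' B) = P (A ⇒' B) × (Slash A → Slash B)

  Slash⇒P : ∀ {A} → Slash A → P A
  Slash⇒P {atom p} s = s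
  Slash⇒P {⊤'} s = s
  Slash⇒P {A ∧' B} = proj₁
  Slash⇒P {A ∨' B} = proj₁
  Slash⇒P {A ⇒' B} = proj₁

  SlashSuccedent : Maybe Formula → Set
  SlashSuccedent nothing = Empty
  SlashSuccedent (just A) = Slash A

  ClosedUnder : List Derivation → Set
  ClosedUnder = All λ { (Γ , C , _) → All P Γ → P C }

  mutual
    slash-sound : ∀ {Γ Δ} (d : LJ Γ Δ) → ClosedUnder (derivations d) → All Slash Γ → SlashSuccedent Δ
    slash-sound d closed = slash-step d (++⁻ (root d) closed)

    private
      slash-step : ∀ {Γ Δ} (d : LJ Γ Δ) → ClosedUnder (root d) × ClosedUnder (subderivations d) →
                   All Slash Γ → SlashSuccedent Δ
      slash-step (ax A) _ (s ∷ []) = s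
      slash-step ax-⊤ (closed ∷ [] , _) [] = closed []
      slash-step ax-⊥ _ (() ∷ [])
      slash-step (wL A d) (_ , c) (_ ∷ ss) = slash-sound d c ss
      slash-step (wR A d) (_ , c) ss = ⊥-elim (slash-sound d c ss)
      slash-step (cL d) (_ , c) (s ∷ ss) = slash-sound d c (s ∷ s ∷ ss)
      slash-step (exL {Γ} d) (_ , c) ss with ++⁻ Γ ss
      ... | ss₁ , b ∷ a ∷ ss₂ = slash-sound d c (++⁺ ss₁ (a ∷ b ∷ ss₂))
      slash-step (cut {Γ} A d e) (_ , c) ss with ++⁻ Γ ss | ++⁻ (derivations d) c
      ... | ss₁ , ss₂ | cd , ce = slash-sound e ce (slash-sound d cd ss₁ ∷ ss₂)
      slash-step (∧R d e) (closed ∷ [] , c) ss with ++⁻ (derivations d) c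
      ... | cd , ce = closed (All.map Slash⇒P ss) , slash-sound d cd ss , slash-sound e ce ss
      slash-step (∧L₁ B d) (_ , c) ((_ , a , _) ∷ ss) = slash-sound d c (a ∷ ss)
      slash-step (∧L₂ A d) (_ , c) ((_ , _ , b) ∷ ss) = slash-sound d c (b ∷ ss)
      slash-step (∨R₁ B d) (closed ∷ [] , c) ss = closed (All.map Slash⇒P ss) , inj₁ (slash-sound d c ss)
      slash-step (∨R₂ A d) (closed ∷ [] , c) ss = closed (All.map Slash⇒P ss) , inj₂ (slash-sound d c ss)
      slash-step (∨L d e) (_ , c) ((_ , a⊎b) ∷ ss) with ++⁻ (derivations d) c | a⊎b
      ... | cd , _ | inj₁ a = slash-sound d cd (a ∷ ss)
      ... | _ , ce | inj₂ b = slash-sound e ce (b ∷ ss)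
      slash-step (⇒R d) (closed ∷ [] , c) ss = closed (All.map Slash⇒P ss) , λ a → slash-sound d c (a ∷ ss)
      slash-step (⇒L {Γ} d e) (_ , c) ((_ , f) ∷ ss) with ++⁻ Γ ss | ++⁻ (derivations d) c
      ... | ss₁ , ss₂ | cd , ce = slash-sound e ce (f (slash-sound d cd ss₁) ∷ ss₂)

⊆∧⊄⇒⊇ : ∀ {n} {p q : Subset n} → p Subset.⊆ q → ¬ p Subset.⊂ q → q Subset.⊆ p
⊆∧⊄⇒⊇ {p = p} p⊆q p⊄q {x} x∈q with x Subsetₚ.∈? p
... | yes x∈p = x∈p
... | no x∉p = ⊥-elim (p⊄q (p⊆q , x , x∈q , x∉p))

module Kleene {n} (f : Subset n → Subset n) (f-inflationary : ∀ p → p Subset.⊆ f p) where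

  approximant : ℕ → Subset n
  approximant zero = Subset.⊥
  approximant (suc t) = f (approximant t)

  private
    fixed-or-growing : ∀ t → f (approximant t) ≡ approximant t ⊎ t ≤ ∣ approximant t ∣
    fixed-or-growing zero = inj₂ z≤n
    fixed-or-growing (suc t) with fixed-or-growing t
    ... | inj₁ fixed = inj₁ (cong f fixed)
    ... | inj₂ t≤∣pₜ∣ with approximant t Subsetₚ.⊂? f (approximant t)
    ...   | yes pₜ⊂fpₜ = inj₂ (≤-<-trans t≤∣pₜ∣ (p⊂q⇒∣p∣<∣q∣ pₜ⊂fpₜ))
    ...   | no pₜ⊄fpₜ =
      inj₁ (cong f (⊆-antisym (⊆∧⊄⇒⊇ (f-inflationary _) pₜ⊄fpₜ) (f-inflationary _)))

  approximant-fixed : f (approximant (suc n)) ≡ approximant (suc n)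
  approximant-fixed with fixed-or-growing (suc n)
  ... | inj₁ fixed = fixed
  ... | inj₂ n<∣p∣ = ⊥-elim (≤⇒≯ (∣p∣≤n (approximant (suc n))) n<∣p∣)

infixr 6 _∧ᵉ_
infixr 5 _∨ᵉ_

-- Monotone formulas over the atoms of φ whose n variables stand for previously computed formulas.
data Expr (φ : Formula) (n : ℕ) : Set where
  var : Fin n → Expr φ n
  atomᵉ : ∀ {p} → Occurs p φ → Expr φ n
  ⊤ᵉ ⊥ᵉ : Expr φ n
  _∧ᵉ_ _∨ᵉ_ : Expr φ n → Expr φ n → Expr φ n

module _ {φ : Formula} {n : ℕ} where

  fill : (Fin n → Formula) → Expr φ n → Formula
  fill F (var i) = F i
  fill F (atomᵉ {p} _) = atom p
  fill F ⊤ᵉ = ⊤'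
  fill F ⊥ᵉ = ⊥'
  fill F (a ∧ᵉ b) = fill F a ∧' fill F b
  fill F (a ∨ᵉ b) = fill F a ∨' fill F b

  fill-atoms : ∀ {F} → (∀ i {p} → Occurs p (F i) → Occurs p φ) →
               ∀ e {p} → Occurs p (fill F e) → Occurs p φ
  fill-atoms h (var i) o = h i o
  fill-atoms h (atomᵉ o) o-atom = o
  fill-atoms h (a ∧ᵉ b) (o-∧l o) = fill-atoms h a o
  fill-atoms h (a ∧ᵉ b) (o-∧r o) = fill-atoms h b o
  fill-atoms h (a ∨ᵉ b) (o-∨l o) = fill-atoms h a o
  fill-atoms h (a ∨ᵉ b) (o-∨r o) = fill-atoms h b o

  evalᵉ : List ℕ → (Fin n → Bool) → Expr φ n → Bool
  evalᵉ S v (var i) = v i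
  evalᵉ S v (atomᵉ {p} _) = eval S (atom p)
  evalᵉ S v ⊤ᵉ = true
  evalᵉ S v ⊥ᵉ = false
  evalᵉ S v (a ∧ᵉ b) = evalᵉ S v a ∧ evalᵉ S v b
  evalᵉ S v (a ∨ᵉ b) = evalᵉ S v a ∨ evalᵉ S v b

  eval-fill : ∀ S F e → eval S (fill F e) ≡ evalᵉ S (eval S ∘ F) e
  eval-fill S F (var i) = refl
  eval-fill S F (atomᵉ _) = refl
  eval-fill S F ⊤ᵉ = refl
  eval-fill S F ⊥ᵉ = refl
  eval-fill S F (a ∧ᵉ b) = cong₂ _∧_ (eval-fill S F a) (eval-fill S F b)
  eval-fill S F (a ∨ᵉ b) = cong₂ _∨_ (eval-fill S F a) (eval-fill S F b)

  evalᵉ-cong : ∀ S {v w} → v ≗ w → ∀ e → evalᵉ S v e ≡ evalᵉ S w e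
  evalᵉ-cong S v≗w (var i) = v≗w i
  evalᵉ-cong S v≗w (atomᵉ _) = refl
  evalᵉ-cong S v≗w ⊤ᵉ = refl
  evalᵉ-cong S v≗w ⊥ᵉ = refl
  evalᵉ-cong S v≗w (a ∧ᵉ b) = cong₂ _∧_ (evalᵉ-cong S v≗w a) (evalᵉ-cong S v≗w b)
  evalᵉ-cong S v≗w (a ∨ᵉ b) = cong₂ _∨_ (evalᵉ-cong S v≗w a) (evalᵉ-cong S v≗w b)

  gates : Expr φ n → ℕ
  gates (var _) = 0
  gates (atomᵉ _) = 1
  gates ⊤ᵉ = 1
  gates ⊥ᵉ = 1
  gates (a ∧ᵉ b) = suc (gates a + gates b)
  gates (a ∨ᵉ b) = suc (gates a + gates b)

  ⋁ : ∀ {m} → (Fin m → Expr φ n) → Expr φ n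
  ⋁ {zero} f = ⊥ᵉ
  ⋁ {suc m} f = f zero ∨ᵉ ⋁ (f ∘ suc)

  ⋁-⊢ : ∀ {m F G} (f : Fin m → Expr φ n) → (∀ i → fill F (f i) ⊢ G) → fill F (⋁ f) ⊢ G
  ⋁-⊢ {zero} f h = ex-falso
  ⋁-⊢ {suc m} f h = ∨L (h zero) (⋁-⊢ (f ∘ suc) (h ∘ suc))

  ⋁-true : ∀ {m S v} (f : Fin m → Expr φ n) i → T (evalᵉ S v (f i)) → T (evalᵉ S v (⋁ f))
  ⋁-true f zero h = from T-∨ (inj₁ h)
  ⋁-true f (suc i) h = from T-∨ (inj₂ (⋁-true (f ∘ suc) i h))

  totalGates : ∀ {m} → (Fin m → Expr φ n) → ℕ
  totalGates {zero} es = 0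
  totalGates {suc m} es = gates (es zero) + totalGates (es ∘ suc)

  totalGates-≤ : ∀ {m b} (es : Fin m → Expr φ n) → (∀ j → gates (es j) ≤ b) → totalGates es ≤ m * b
  totalGates-≤ {zero} es h = z≤n
  totalGates-≤ {suc m} es h = +-mono-≤ (h zero) (totalGates-≤ (es ∘ suc) (h ∘ suc))

  gates-⋁ : ∀ {m b} (f : Fin m → Expr φ n) → (∀ i → gates (f i) ≤ b) → gates (⋁ f) ≤ suc (m * suc b)
  gates-⋁ {zero} f h = ≤-refl
  gates-⋁ {suc m} {b} f h =
    s≤s (≤-trans (+-mono-≤ (h zero) (gates-⋁ (f ∘ suc) (h ∘ suc))) (≤-reflexive (+-suc b (m * suc b))))

unfold : ∀ {k} → Circuit k → Fin k → Formula
unfold c = Vec.lookup (unfoldAll c)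

unfold-newest : ∀ {k} (c : Circuit k) g → unfold (c ▷ g) (fromℕ k) ≡ gateFormula (unfoldAll c) g
unfold-newest c g = lookup-∷ʳ-fromℕ (unfoldAll c)
  where
  lookup-∷ʳ-fromℕ : ∀ {k} (xs : Vec Formula k) {x} → Vec.lookup (xs ∷ʳ x) (fromℕ k) ≡ x
  lookup-∷ʳ-fromℕ [] = refl
  lookup-∷ʳ-fromℕ (_ ∷ xs) = lookup-∷ʳ-fromℕ xs

unfold-inject₁ : ∀ {k} (c : Circuit k) g i → unfold (c ▷ g) (inject₁ i) ≡ unfold c i
unfold-inject₁ c g = lookup-∷ʳ-inject₁ (unfoldAll c)
  where
  lookup-∷ʳ-inject₁ : ∀ {k} (xs : Vec Formula k) {x} i → Vec.lookup (xs ∷ʳ x) (inject₁ i) ≡ Vec.lookup xs i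
  lookup-∷ʳ-inject₁ (_ ∷ xs) zero = refl
  lookup-∷ʳ-inject₁ (_ ∷ xs) (suc i) = lookup-∷ʳ-inject₁ xs i

⟦▷⟧ : ∀ {k} (c : Circuit k) g → ⟦ c ▷ g ⟧ ≡ gateFormula (unfoldAll c) g
⟦▷⟧ c g = last-∷ʳ _ (unfoldAll c)

infix 4 _≼_
record _≼_ {k k'} (c : Circuit k) (c' : Circuit k') : Set where
  field
    embed : Fin k → Fin k'
    unfold-embed : ∀ i → unfold c' (embed i) ≡ unfold c i
open _≼_

≼-refl : ∀ {k} {c : Circuit k} → c ≼ c
≼-refl = record { embed = id ; unfold-embed = λ _ → refl }

≼-trans : ∀ {k k' k''} {c : Circuit k} {c' : Circuit k'} {c'' : Circuit k''} →
          c ≼ c' → c' ≼ c'' → c ≼ c''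
≼-trans c≼c' c'≼c'' = record
  { embed = embed c'≼c'' ∘ embed c≼c'
  ; unfold-embed = λ i → trans (unfold-embed c'≼c'' _) (unfold-embed c≼c' i) }

≼-▷ : ∀ {k} {c : Circuit k} {g} → c ≼ c ▷ g
≼-▷ {c = c} {g} = record { embed = inject₁ ; unfold-embed = unfold-inject₁ c g }

record Computing {k} (c : Circuit k) (A : Formula) (cost : ℕ) : Set where
  field
    {size} : ℕ
    circuit : Circuit size
    extends : c ≼ circuit
    output : Fin size
    unfold-output : unfold circuit output ≡ A
    size≡ : size ≡ k + cost
open Computing

newGate : ∀ {k} (c : Circuit k) g → Computing c (gateFormula (unfoldAll c) g) 1
newGate {k} c g = record
  { circuit = c ▷ g ; extends = ≼-▷ ; output = fromℕ k ; unfold-output = unfold-newest c g ; size≡ = +-comm 1 k }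

binaryGate : ∀ {k} {c : Circuit k} {A B m m'}
             (gate : ∀ {j} → Fin j → Fin j → Gate j) (_∙_ : Formula → Formula → Formula) →
             (∀ {j} (v : Vec Formula j) i i' → gateFormula v (gate i i') ≡ Vec.lookup v i ∙ Vec.lookup v i') →
             (ra : Computing c A m) → Computing (circuit ra) B m' → Computing c (A ∙ B) (suc (m + m'))
binaryGate {k} {m = m} {m'} gate _∙_ gate-unfolds ra rb = record
  { circuit = circuit rb ▷ g
  ; extends = ≼-trans (≼-trans (extends ra) (extends rb)) ≼-▷
  ; output = fromℕ _
  ; unfold-output = trans (unfold-newest (circuit rb) g)
      (trans (gate-unfolds (unfoldAll (circuit rb)) _ _)
        (cong₂ _∙_ (trans (unfold-embed (extends rb) (output ra)) (unfold-output ra)) (unfold-output rb)))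
  ; size≡ = trans (cong suc (trans (size≡ rb) (trans (cong (_+ m') (size≡ ra)) (+-assoc k m m'))))
                  (sym (+-suc k (m + m'))) }
  where
  g : Gate (size rb)
  g = gate (embed (extends rb) (output ra)) (output rb)

≼-transport : ∀ {n k k'} {c : Circuit k} {c' : Circuit k'} {ρ : Fin n → Fin k} {F} →
              (c≼c' : c ≼ c') → unfold c ∘ ρ ≗ F → unfold c' ∘ embed c≼c' ∘ ρ ≗ F
≼-transport {ρ = ρ} c≼c' ρ≗F i = trans (unfold-embed c≼c' (ρ i)) (ρ≗F i)

compile : ∀ {φ n k} (c : Circuit k) (ρ : Fin n → Fin k) {F} → unfold c ∘ ρ ≗ F →
          (e : Expr φ n) → Computing c (fill F e) (gates e)
compile {k = k} c ρ ρ≗F (var i) = record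
  { circuit = c ; extends = ≼-refl ; output = ρ i ; unfold-output = ρ≗F i ; size≡ = sym (+-identityʳ k) }
compile c ρ ρ≗F (atomᵉ {p} _) = newGate c (input p)
compile c ρ ρ≗F ⊤ᵉ = newGate c top
compile c ρ ρ≗F ⊥ᵉ = newGate c bot
compile c ρ {F} ρ≗F (a ∧ᵉ b) = binaryGate and _∧'_ (λ _ _ _ → refl) ra rb
  where
  ra : Computing c (fill F a) (gates a)
  ra = compile c ρ ρ≗F a
  rb : Computing (circuit ra) (fill F b) (gates b)
  rb = compile (circuit ra) (embed (extends ra) ∘ ρ) (≼-transport (extends ra) ρ≗F) b
compile c ρ {F} ρ≗F (a ∨ᵉ b) = binaryGate or _∨'_ (λ _ _ _ → refl) ra rb
  where
  ra : Computing c (fill F a) (gates a)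
  ra = compile c ρ ρ≗F a
  rb : Computing (circuit ra) (fill F b) (gates b)
  rb = compile (circuit ra) (embed (extends ra) ∘ ρ) (≼-transport (extends ra) ρ≗F) b

record ComputingAll {k} (c : Circuit k) {m} (F : Fin m → Formula) (cost : ℕ) : Set where
  field
    {size} : ℕ
    circuit : Circuit size
    extends : c ≼ circuit
    outputs : Fin m → Fin size
    unfold-outputs : unfold circuit ∘ outputs ≗ F
    size≡ : size ≡ k + cost
open ComputingAll

compileAll : ∀ {φ n k m} (c : Circuit k) (ρ : Fin n → Fin k) {F} → unfold c ∘ ρ ≗ F →
             (es : Fin m → Expr φ n) → ComputingAll c (fill F ∘ es) (totalGates es)
compileAll {k = k} {zero} c ρ ρ≗F es = record
  { circuit = c ; extends = ≼-refl ; outputs = λ () ; unfold-outputs = λ () ; size≡ = sym (+-identityʳ k) }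
compileAll {k = k} {suc m} c ρ {F} ρ≗F es = record
  { circuit = circuit rs
  ; extends = ≼-trans (extends r₀) (extends rs)
  ; outputs = λ { zero → embed (extends rs) (output r₀) ; (suc j) → outputs rs j }
  ; unfold-outputs = λ { zero → trans (unfold-embed (extends rs) (output r₀)) (unfold-output r₀)
                       ; (suc j) → unfold-outputs rs j }
  ; size≡ = trans (size≡ rs) (trans (cong (_+ totalGates (es ∘ suc)) (size≡ r₀)) (+-assoc k _ _)) }
  where
  r₀ : Computing c (fill F (es zero)) (gates (es zero))
  r₀ = compile c ρ ρ≗F (es zero)
  rs : ComputingAll (circuit r₀) (fill F ∘ es ∘ suc) (totalGates (es ∘ suc))
  rs = compileAll (circuit r₀) (embed (extends r₀) ∘ ρ) (≼-transport (extends r₀) ρ≗F) (es ∘ suc)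

-- ⟦_⟧ reads the last gate, so the output is copied into a new last gate.
outputLast : ∀ {k A m} {c : Circuit k} (r : Computing c A m) → Circuit (suc (size r))
outputLast r = circuit r ▷ or (output r) (output r)

⟦outputLast⟧ : ∀ {k A m} {c : Circuit k} (r : Computing c A m) → ⟦ outputLast r ⟧ ≡ A ∨' A
⟦outputLast⟧ r = trans (⟦▷⟧ (circuit r) _) (cong₂ _∨'_ (unfold-output r) (unfold-output r))

subformulas : Formula → List Formula
subformulas (atom p) = atom p ∷ []
subformulas ⊤' = ⊤' ∷ []
subformulas ⊥' = ⊥' ∷ []
subformulas (A ∧' B) = (A ∧' B) ∷ subformulas A ++ subformulas B
subformulas (A ∨' B) = (A ∨' B) ∷ subformulas A ++ subformulas B
subformulas (A ⇒' B) = (A ⇒' B) ∷ subformulas A ++ subformulas B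

mutual
  length-subformulas : ∀ A → length (subformulas A) ≤ fsize A
  length-subformulas (atom _) = ≤-refl
  length-subformulas ⊤' = ≤-refl
  length-subformulas ⊥' = ≤-refl
  length-subformulas (A ∧' B) = s≤s (length-subformulas₂ A B)
  length-subformulas (A ∨' B) = s≤s (length-subformulas₂ A B)
  length-subformulas (A ⇒' B) = s≤s (length-subformulas₂ A B)

  length-subformulas₂ : ∀ A B → length (subformulas A ++ subformulas B) ≤ fsize A + fsize B
  length-subformulas₂ A B =
    ≤-trans (≤-reflexive (length-++ (subformulas A))) (+-mono-≤ (length-subformulas A) (length-subformulas B))

fsize-positive : ∀ A → 1 ≤ fsize A
fsize-positive (atom _) = ≤-refl
fsize-positive ⊤' = ≤-refl
fsize-positive ⊥' = ≤-refl
fsize-positive (_ ∧' _) = s≤s z≤n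
fsize-positive (_ ∨' _) = s≤s z≤n
fsize-positive (_ ⇒' _) = s≤s z≤n

length≤sumF : ∀ Γ → length Γ ≤ sumF Γ
length≤sumF [] = z≤n
length≤sumF (A ∷ Γ) = +-mono-≤ (fsize-positive A) (length≤sumF Γ)

2+length≤seqSize : ∀ Γ C → 2 + length Γ ≤ seqSize Γ (just C)
2+length≤seqSize Γ C =
  s≤s (≤-trans (≤-reflexive (+-comm 1 (length Γ))) (+-mono-≤ (length≤sumF Γ) (fsize-positive C)))

weight : List Derivation → ℕ
weight [] = 0
weight ((Γ , C , _) ∷ ds) = seqSize Γ (just C) + weight ds

weight-++ : ∀ ds ds' → weight (ds ++ ds') ≡ weight ds + weight ds'
weight-++ [] ds' = refl
weight-++ ((Γ , C , _) ∷ ds) ds' =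
  trans (cong (seqSize Γ (just C) +_) (weight-++ ds ds')) (sym (+-assoc (seqSize Γ (just C)) (weight ds) (weight ds')))

weight-++-mono : ∀ ds {ds' c c'} → weight ds ≤ c → weight ds' ≤ c' → weight (ds ++ ds') ≤ c + c'
weight-++-mono ds h h' = ≤-trans (≤-reflexive (weight-++ ds _)) (+-mono-≤ h h')

length≤weight : ∀ ds → length ds ≤ weight ds
length≤weight [] = z≤n
length≤weight (_ ∷ ds) = +-mono-≤ (s≤s z≤n) (length≤weight ds)

weight-root : ∀ {Γ Δ} (d : LJ Γ Δ) → weight (root d) ≤ seqSize Γ Δ
weight-root {Δ = just C} d = ≤-reflexive (+-identityʳ _)
weight-root {Δ = nothing} d = z≤n

weight-node : ∀ {Γ Δ} (d : LJ Γ Δ) {c} → weight (subderivations d) ≤ c →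
              weight (derivations d) ≤ seqSize Γ Δ + c
weight-node d = weight-++-mono (root d) (weight-root d)

weight≤codeLength : ∀ {Γ Δ} (d : LJ Γ Δ) → weight (derivations d) ≤ codeLength d
weight≤codeLength (ax _) = ≤-reflexive (+-identityʳ _)
weight≤codeLength ax-⊤ = ≤-reflexive (+-identityʳ _)
weight≤codeLength ax-⊥ = z≤n
weight≤codeLength d@(wL _ d₁) = weight-node d (weight≤codeLength d₁)
weight≤codeLength d@(wR _ d₁) = weight-node d (weight≤codeLength d₁)
weight≤codeLength d@(cL d₁) = weight-node d (weight≤codeLength d₁)
weight≤codeLength d@(exL d₁) = weight-node d (weight≤codeLength d₁)
weight≤codeLength d@(cut _ d₁ d₂) =
  weight-node d (weight-++-mono (derivations d₁) (weight≤codeLength d₁) (weight≤codeLength d₂))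
weight≤codeLength d@(∧R d₁ d₂) =
  weight-node d (weight-++-mono (derivations d₁) (weight≤codeLength d₁) (weight≤codeLength d₂))
weight≤codeLength d@(∧L₁ _ d₁) = weight-node d (weight≤codeLength d₁)
weight≤codeLength d@(∧L₂ _ d₁) = weight-node d (weight≤codeLength d₁)
weight≤codeLength d@(∨R₁ _ d₁) = weight-node d (weight≤codeLength d₁)
weight≤codeLength d@(∨R₂ _ d₁) = weight-node d (weight≤codeLength d₁)
weight≤codeLength d@(∨L d₁ d₂) =
  weight-node d (weight-++-mono (derivations d₁) (weight≤codeLength d₁) (weight≤codeLength d₂))
weight≤codeLength d@(⇒R d₁) = weight-node d (weight≤codeLength d₁)
weight≤codeLength d@(⇒L d₁ d₂) =
  weight-node d (weight-++-mono (derivations d₁) (weight≤codeLength d₁) (weight≤codeLength d₂))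

fsize≤weight : ∀ {A B} (u : LJProof (A ⇒' B)) → fsize A ≤ weight (derivations u)
fsize≤weight {A} {B} u =
  ≤-trans (m≤m+n (fsize A) (fsize B)) (≤-trans (n≤1+n _) (≤-trans (n≤1+n _) (m≤m+n _ _)))

-- With n = |Σ| and w the weight of the sequents of u: testing whether a formula is derived costs less than
-- unitCost n gates, and one round for one formula at most nextCost n w gates.
unitCost : ℕ → ℕ
unitCost n = suc n * 2

nextCost : ℕ → ℕ → ℕ
nextCost n w = 2 + ((unitCost n + unitCost n) + suc (w * unitCost n))

sizeBound : ℕ → ℕ → ℕ
sizeBound n w = 2 + (suc n * (n * nextCost n w) + unitCost n)

sizeBound-mono : ∀ {n n' w w'} → n ≤ n' → w ≤ w' → sizeBound n w ≤ sizeBound n' w'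
sizeBound-mono {n} {n'} {w} {w'} n≤n' w≤w' =
  s≤s (s≤s (+-mono-≤ (*-mono-≤ (s≤s n≤n') (*-mono-≤ n≤n' nextCost-mono)) unitCost-mono))
  where
  unitCost-mono : unitCost n ≤ unitCost n'
  unitCost-mono = *-monoˡ-≤ 2 (s≤s n≤n')
  nextCost-mono : nextCost n w ≤ nextCost n' w'
  nextCost-mono =
    s≤s (s≤s (+-mono-≤ (+-mono-≤ unitCost-mono unitCost-mono) (s≤s (*-mono-≤ w≤w' unitCost-mono))))

-- The sets D(S) of the proof idea, for Σ = formulas: approx t j is true under S iff formula j enters D(S)
-- within t rounds, and Semantics.Derived S is membership in D(S).
module Closure (φ : Formula) (derivs : List Derivation) where

  formulas : List Formula
  formulas = subformulas φ ++ map conclusion derivs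

  n : ℕ
  n = length formulas

  formula : Fin n → Formula
  formula = lookup formulas

  guard : ∀ {A B : Formula} → Dec (A ≡ B) → Expr φ n → Expr φ n
  guard (yes _) e = e
  guard (no _) _ = ⊥ᵉ

  derived : Formula → Expr φ n
  derived G = ⋁ λ j → guard (formula j ≟ G) (var j)

  allDerived : List Formula → Expr φ n
  allDerived [] = ⊤ᵉ
  allDerived (G ∷ Γ) = derived G ∧ᵉ allDerived Γ

  byDerivation : List Derivation → Formula → Expr φ n
  byDerivation [] C = ⊥ᵉ
  byDerivation ((Γ , C' , _) ∷ ds) C = guard (C' ≟ C) (allDerived Γ) ∨ᵉ byDerivation ds C

  atomIf : ∀ {p} → Dec (Occurs p φ) → Expr φ n
  atomIf (yes p∈φ) = atomᵉ p∈φ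
  atomIf (no _) = ⊥ᵉ

  byIntroduction : Formula → Expr φ n
  byIntroduction (atom p) = atomIf (occurs? p φ)
  byIntroduction ⊤' = ⊤ᵉ
  byIntroduction ⊥' = ⊥ᵉ
  byIntroduction (A ∧' B) = derived A ∧ᵉ derived B
  byIntroduction (A ∨' B) = derived A ∨ᵉ derived B
  byIntroduction (A ⇒' B) = ⊥ᵉ

  byRule : Formula → Expr φ n
  byRule C = byIntroduction C ∨ᵉ byDerivation derivs C

  next : Fin n → Expr φ n
  next j = var j ∨ᵉ byRule (formula j)

  approx : ℕ → Fin n → Formula
  approx zero j = ⊥'
  approx (suc t) j = fill (approx t) (next j)

  module _ {F : Fin n → Formula} (F-sound : ∀ j → F j ⊢ formula j) where

    guard-⊢ : ∀ {A B G} (d : Dec (A ≡ B)) e → (A ≡ B → fill F e ⊢ G) → fill F (guard d e) ⊢ G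
    guard-⊢ (yes A≡B) e h = h A≡B
    guard-⊢ (no _) e h = ex-falso

    derived-sound : ∀ G → fill F (derived G) ⊢ G
    derived-sound G = ⋁-⊢ _ λ j → guard-⊢ (formula j ≟ G) (var j) λ { refl → F-sound j }

    allDerived-sound : ∀ Γ → fill F (allDerived Γ) ⊢ ⋀ Γ
    allDerived-sound [] = ⊢-refl
    allDerived-sound (G ∷ Γ) = ∧-map (derived-sound G) (allDerived-sound Γ)

    byDerivation-sound : ∀ ds C → fill F (byDerivation ds C) ⊢ C
    byDerivation-sound [] C = ex-falso
    byDerivation-sound ((Γ , C' , d) ∷ ds) C =
      ∨L (guard-⊢ (C' ≟ C) _ λ { refl → allDerived-sound Γ ⨾ LJ⇒⋀⊢ d }) (byDerivation-sound ds C)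

    byIntroduction-sound : ∀ C → fill F (byIntroduction C) ⊢ C
    byIntroduction-sound (atom p) with occurs? p φ
    ... | yes _ = ⊢-refl
    ... | no _ = ex-falso
    byIntroduction-sound ⊤' = ⊢-refl
    byIntroduction-sound ⊥' = ex-falso
    byIntroduction-sound (A ∧' B) = ∧-map (derived-sound A) (derived-sound B)
    byIntroduction-sound (A ∨' B) = ∨-map (derived-sound A) (derived-sound B)
    byIntroduction-sound (A ⇒' B) = ex-falso

    next-sound : ∀ j → fill F (next j) ⊢ formula j
    next-sound j = ∨L (F-sound j) (∨L (byIntroduction-sound _) (byDerivation-sound derivs _))

  approx-sound : ∀ t j → approx t j ⊢ formula j
  approx-sound zero j = ex-falso
  approx-sound (suc t) j = next-sound (approx-sound t) j

  approx-atoms : ∀ t j {p} → Occurs p (approx t j) → Occurs p φ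
  approx-atoms zero j ()
  approx-atoms (suc t) j = fill-atoms (approx-atoms t) (next j)

  module Semantics (S : List ℕ) where

    step : Subset n → Subset n
    step s = Vec.tabulate λ j → evalᵉ S (Vec.lookup s) (next j)

    lookup-step : ∀ s j → Vec.lookup (step s) j ≡ evalᵉ S (Vec.lookup s) (next j)
    lookup-step s = lookup∘tabulate λ j → evalᵉ S (Vec.lookup s) (next j)

    step-inflationary : ∀ s → s Subset.⊆ step s
    step-inflationary s {j} j∈s =
      lookup⇒[]= j (step s)
        (to T-≡ (subst T (sym (lookup-step s j)) (from T-∨ (inj₁ (from T-≡ ([]=⇒lookup j∈s))))))

    open Kleene step step-inflationary

    fixpoint : Subset n
    fixpoint = approximant (suc n)

    fixpoint-unfold : ∀ j → evalᵉ S (Vec.lookup fixpoint) (next j) ≡ Vec.lookup fixpoint j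
    fixpoint-unfold j =
      trans (sym (lookup-step fixpoint j)) (cong (λ s → Vec.lookup s j) approximant-fixed)

    eval-approx : ∀ t j → eval S (approx t j) ≡ Vec.lookup (approximant t) j
    eval-approx zero j = sym (lookup-replicate j false)
    eval-approx (suc t) j = begin
      eval S (fill (approx t) (next j))                     ≡⟨ eval-fill S (approx t) (next j) ⟩
      evalᵉ S (eval S ∘ approx t) (next j)                  ≡⟨ evalᵉ-cong S (eval-approx t) (next j) ⟩
      evalᵉ S (Vec.lookup (approximant t)) (next j)         ≡⟨ lookup-step (approximant t) j ⟨
      Vec.lookup (approximant (suc t)) j                    ∎
      where open ≡-Reasoning

    Derived : Formula → Set
    Derived G = T (evalᵉ S (Vec.lookup fixpoint) (derived G))

    guard-true : ∀ {A B} (d : Dec (A ≡ B)) {e} → A ≡ B →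
                 T (evalᵉ S (Vec.lookup fixpoint) e) → T (evalᵉ S (Vec.lookup fixpoint) (guard d e))
    guard-true (yes _) _ h = h
    guard-true (no A≢B) A≡B _ = ⊥-elim (A≢B A≡B)

    fixpoint⇒Derived : ∀ j → T (Vec.lookup fixpoint j) → Derived (formula j)
    fixpoint⇒Derived j h = ⋁-true _ j (guard-true (formula j ≟ formula j) refl h)

    Derived-by-rule : ∀ {C} → C ∈ formulas → T (evalᵉ S (Vec.lookup fixpoint) (byRule C)) → Derived C
    Derived-by-rule C∈fs = subst (λ A → T (evalᵉ S (Vec.lookup fixpoint) (byRule A)) → Derived A)
                                 (sym (lookup-index C∈fs)) (by-rule (Any.index C∈fs))
      where
      by-rule : ∀ j → T (evalᵉ S (Vec.lookup fixpoint) (byRule (formula j))) → Derived (formula j)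
      by-rule j h =
        fixpoint⇒Derived j (subst T (fixpoint-unfold j) (from (T-∨ {Vec.lookup fixpoint j}) (inj₂ h)))

    Derived-∧ : ∀ {A B} → A ∧' B ∈ formulas → Derived A → Derived B → Derived (A ∧' B)
    Derived-∧ m a b = Derived-by-rule m (from T-∨ (inj₁ (from T-∧ (a , b))))

    Derived-∨ : ∀ {A B} → A ∨' B ∈ formulas → Derived A ⊎ Derived B → Derived (A ∨' B)
    Derived-∨ m a⊎b = Derived-by-rule m (from T-∨ (inj₁ (from T-∨ a⊎b)))

    Derived-⊤ : ⊤' ∈ formulas → Derived ⊤'
    Derived-⊤ m = Derived-by-rule m tt

    Derived-atom : ∀ {p} → atom p ∈ formulas → Occurs p φ → T (eval S (atom p)) → Derived (atom p)
    Derived-atom {p} m p∈φ h = Derived-by-rule m (from T-∨ (inj₁ (atomIf-true (occurs? p φ))))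
      where
      atomIf-true : (d : Dec (Occurs p φ)) → T (evalᵉ S (Vec.lookup fixpoint) (atomIf d))
      atomIf-true (yes _) = h
      atomIf-true (no p∉φ) = ⊥-elim (p∉φ p∈φ)

    allDerived-true : ∀ {Γ} → All Derived Γ → T (evalᵉ S (Vec.lookup fixpoint) (allDerived Γ))
    allDerived-true [] = tt
    allDerived-true (g ∷ gs) = from T-∧ (g , allDerived-true gs)

    byDerivation-true : ∀ {ds Γ C d} → (Γ , C , d) ∈ ds → All Derived Γ →
                        T (evalᵉ S (Vec.lookup fixpoint) (byDerivation ds C))
    byDerivation-true {C = C} (here refl) gs =
      from T-∨ (inj₁ (guard-true (C ≟ C) refl (allDerived-true gs)))
    byDerivation-true (there m) gs = from T-∨ (inj₂ (byDerivation-true m gs))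

    open Slash Derived

    Derived-closed : ClosedUnder derivs
    Derived-closed = All.tabulate λ { {Γ , C , d} m gs →
      Derived-by-rule (∈-++⁺ʳ (subformulas φ) (∈-map⁺ conclusion m))
                      (from T-∨ (inj₂ (byDerivation-true m gs))) }

    slash-of-true : ∀ {A} → Monotone A → subformulas A ⊆ formulas → (∀ {p} → Occurs p A → Occurs p φ) →
                    T (eval S A) → Slash A
    slash-of-true (m-atom p) sub occ h = Derived-atom (sub (here refl)) (occ o-atom) h
    slash-of-true m-⊤ sub occ h = Derived-⊤ (sub (here refl))
    slash-of-true (m-∧ mA mB) sub occ h =
      let a , b = to T-∧ h
          sa = slash-of-true mA (λ m → sub (there (∈-++⁺ˡ m))) (λ o → occ (o-∧l o)) a
          sb = slash-of-true mB (λ m → sub (there (∈-++⁺ʳ _ m))) (λ o → occ (o-∧r o)) b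
      in Derived-∧ (sub (here refl)) (Slash⇒P sa) (Slash⇒P sb) , sa , sb
    slash-of-true (m-∨ mA mB) sub occ h =
      let sa⊎sb = Sum.map (slash-of-true mA (λ m → sub (there (∈-++⁺ˡ m))) (λ o → occ (o-∨l o)))
                          (slash-of-true mB (λ m → sub (there (∈-++⁺ʳ _ m))) (λ o → occ (o-∨r o)))
                          (to T-∨ h)
      in Derived-∨ (sub (here refl)) (Sum.map Slash⇒P Slash⇒P sa⊎sb) , sa⊎sb

  interpolant : Formula → Formula
  interpolant G = fill (approx (suc n)) (derived G)

  interpolant-sound : ∀ G → interpolant G ⊢ G
  interpolant-sound = derived-sound (approx-sound (suc n))

  interpolant-atoms : ∀ G {p} → Occurs p (interpolant G) → Occurs p φ
  interpolant-atoms G = fill-atoms (approx-atoms (suc n)) (derived G)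

  eval-interpolant : ∀ S G →
                     eval S (interpolant G) ≡ evalᵉ S (Vec.lookup (Semantics.fixpoint S)) (derived G)
  eval-interpolant S G =
    trans (eval-fill S _ (derived G)) (evalᵉ-cong S (Semantics.eval-approx S (suc n)) (derived G))

  stepCost : ℕ
  stepCost = totalGates next

  stage : ∀ t → ComputingAll ([] ▷ bot) (approx t) (t * stepCost)
  stage zero = record
    { circuit = [] ▷ bot ; extends = ≼-refl ; outputs = λ _ → zero ; unfold-outputs = λ _ → refl ; size≡ = refl }
  stage (suc t) = record
    { circuit = circuit r
    ; extends = ≼-trans (extends st) (extends r)
    ; outputs = outputs r
    ; unfold-outputs = unfold-outputs r
    ; size≡ = trans (size≡ r)
                    (trans (cong (_+ stepCost) (size≡ st)) (cong suc (+-comm (t * stepCost) stepCost))) }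
    where
    st : ComputingAll ([] ▷ bot) (approx t) (t * stepCost)
    st = stage t
    r : ComputingAll (circuit st) (approx (suc t)) stepCost
    r = compileAll (circuit st) (outputs st) (unfold-outputs st) next

  K : ℕ
  K = unitCost n

  gates-guard : ∀ {A B : Formula} (d : Dec (A ≡ B)) e → gates (guard d e) ≤ suc (gates e)
  gates-guard (yes _) e = n≤1+n _
  gates-guard (no _) e = s≤s z≤n

  gates-derived : ∀ G → gates (derived G) ≤ suc (n * 2)
  gates-derived G = gates-⋁ _ λ j → gates-guard (formula j ≟ G) (var j)

  gates-allDerived : ∀ Γ → gates (allDerived Γ) ≤ suc (length Γ) * K
  gates-allDerived [] = s≤s z≤n
  gates-allDerived (G ∷ Γ) = +-mono-≤ (s≤s (gates-derived G)) (gates-allDerived Γ)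

  clause-cost : ∀ Γ C → 2 + suc (length Γ) * K ≤ seqSize Γ (just C) * K
  clause-cost Γ C = ≤-trans (+-monoˡ-≤ _ (s≤s (s≤s z≤n))) (*-monoˡ-≤ K (2+length≤seqSize Γ C))

  gates-byDerivation : ∀ ds C → gates (byDerivation ds C) ≤ suc (weight ds * K)
  gates-byDerivation [] C = ≤-refl
  gates-byDerivation ((Γ , C' , d) ∷ ds) C = begin
    suc (gates (guard (C' ≟ C) (allDerived Γ)) + gates (byDerivation ds C))
      ≤⟨ s≤s (+-mono-≤ (≤-trans (gates-guard (C' ≟ C) _) (s≤s (gates-allDerived Γ)))
                       (gates-byDerivation ds C)) ⟩
    suc (suc (suc (length Γ) * K) + suc (weight ds * K))
      ≡⟨ cong (λ x → suc (suc x)) (+-suc (suc (length Γ) * K) (weight ds * K)) ⟩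
    suc ((2 + suc (length Γ) * K) + weight ds * K)
      ≤⟨ s≤s (+-monoˡ-≤ _ (clause-cost Γ C')) ⟩
    suc (seqSize Γ (just C') * K + weight ds * K)
      ≡⟨ cong suc (*-distribʳ-+ K (seqSize Γ (just C')) (weight ds)) ⟨
    suc (weight ((Γ , C' , d) ∷ ds) * K) ∎
    where open ≤-Reasoning

  gates-byIntroduction : ∀ C → gates (byIntroduction C) ≤ K + K
  gates-byIntroduction (atom p) = gates-atomIf (occurs? p φ)
    where
    gates-atomIf : (d : Dec (Occurs p φ)) → gates (atomIf d) ≤ K + K
    gates-atomIf (yes _) = s≤s z≤n
    gates-atomIf (no _) = s≤s z≤n
  gates-byIntroduction ⊤' = s≤s z≤n
  gates-byIntroduction ⊥' = s≤s z≤n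
  gates-byIntroduction (A ∧' B) = s≤s (+-mono-≤ (gates-derived A) (≤-trans (gates-derived B) (n≤1+n _)))
  gates-byIntroduction (A ∨' B) = s≤s (+-mono-≤ (gates-derived A) (≤-trans (gates-derived B) (n≤1+n _)))
  gates-byIntroduction (A ⇒' B) = s≤s z≤n

  stepCost≤n*nextCost : stepCost ≤ n * nextCost n (weight derivs)
  stepCost≤n*nextCost = totalGates-≤ next λ j →
    s≤s (s≤s (+-mono-≤ (gates-byIntroduction (formula j)) (gates-byDerivation derivs (formula j))))

  computeInterpolant : ∀ G → Computing (circuit (stage (suc n))) (interpolant G) (gates (derived G))
  computeInterpolant G = compile (circuit st) (outputs st) (unfold-outputs st) (derived G)
    where
    st : ComputingAll ([] ▷ bot) (approx (suc n)) (suc n * stepCost)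
    st = stage (suc n)

  computeInterpolant-size : ∀ G → suc (size (computeInterpolant G)) ≤ sizeBound n (weight derivs)
  computeInterpolant-size G = begin
    suc (size (computeInterpolant G))
      ≡⟨ cong suc (size≡ (computeInterpolant G)) ⟩
    suc (size (stage (suc n)) + gates (derived G))
      ≡⟨ cong (λ k → suc (k + gates (derived G))) (size≡ (stage (suc n))) ⟩
    suc (suc (suc n * stepCost + gates (derived G)))
      ≤⟨ s≤s (s≤s (+-mono-≤ (*-monoʳ-≤ (suc n) stepCost≤n*nextCost)
                            (≤-trans (gates-derived G) (n≤1+n _)))) ⟩
    sizeBound n (weight derivs)                     ∎
    where open ≤-Reasoning

module Interpolation {φ ψ θ} (φ-monotone : Monotone φ) (u : LJProof (φ ⇒' ψ ∨' θ)) where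

  open Closure φ (derivations u) public

  derived-disjunct : ∀ S → T (eval S φ) → Semantics.Derived S ψ ⊎ Semantics.Derived S θ
  derived-disjunct S φ-true =
    Sum.map Slash⇒P Slash⇒P (proj₂ (φ⇒ψ∨θ-slash (slash-of-true φ-monotone ∈-++⁺ˡ id φ-true)))
    where
    open Semantics S
    open Slash Derived
    φ⇒ψ∨θ-slash : Slash φ → Slash (ψ ∨' θ)
    φ⇒ψ∨θ-slash = proj₂ (slash-sound u Derived-closed [])

  I : Formula → Formula
  I G = interpolant G ∨' interpolant G

  φ⊢Iψ∨Iθ : φ ⊢ I ψ ∨' I θ
  φ⊢Iψ∨Iθ = monotone-⊢ φ-monotone λ S φ-true →
    eval⇒⊢ (I ψ ∨' I θ) (from T-∨ (Sum.map (I-true S) (I-true S) (derived-disjunct S φ-true)))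
    where
    I-true : ∀ S {G} → Semantics.Derived S G → T (eval S (I G))
    I-true S {G} h = from T-∨ (inj₁ (subst T (sym (eval-interpolant S G)) h))

  I⊢ : ∀ G → I G ⊢ G
  I⊢ G = ∨L (interpolant-sound G) (interpolant-sound G)

  I-atoms : ∀ G p → Occurs p (I G) → Occurs p φ
  I-atoms G p (o-∨l o) = interpolant-atoms G o
  I-atoms G p (o-∨r o) = interpolant-atoms G o

  isPDI : IsPDI φ ψ θ ⟦ outputLast (computeInterpolant ψ) ⟧ ⟦ outputLast (computeInterpolant θ) ⟧
  isPDI rewrite ⟦outputLast⟧ (computeInterpolant ψ) | ⟦outputLast⟧ (computeInterpolant θ) =
    I-atoms ψ , I-atoms θ , ⇒R φ⊢Iψ∨Iθ , ⇒R (I⊢ ψ) , ⇒R (I⊢ θ)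

  n≤2weight : n ≤ weight (derivations u) + weight (derivations u)
  n≤2weight = begin
    length (subformulas φ ++ map conclusion (derivations u))
      ≡⟨ length-++ (subformulas φ) ⟩
    length (subformulas φ) + length (map conclusion (derivations u))
      ≡⟨ cong (length (subformulas φ) +_) (length-map conclusion (derivations u)) ⟩
    length (subformulas φ) + length (derivations u)
      ≤⟨ +-mono-≤ (≤-trans (length-subformulas φ) (fsize≤weight u)) (length≤weight (derivations u)) ⟩
    weight (derivations u) + weight (derivations u)
      ∎
    where open ≤-Reasoning

  circuit-size : ∀ G → suc (size (computeInterpolant G)) ≤ sizeBound (codeLength u + codeLength u) (codeLength u)
  circuit-size G = ≤-trans (computeInterpolant-size G)
    (sizeBound-mono (≤-trans n≤2weight (+-mono-≤ (weight≤codeLength u) (weight≤codeLength u))) (weight≤codeLength u))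

-- evalP sizePolynomial x y reduces to sizeBound (y + y) y.
sizePolynomial : Poly2
sizePolynomial = const 2 ⊕ (((const 1 ⊕ n) ⊗ (n ⊗ next)) ⊕ unit)
  where
  n unit next : Poly2
  n = varY ⊕ varY
  unit = (const 1 ⊕ n) ⊗ const 2
  next = const 2 ⊕ ((unit ⊕ unit) ⊕ (const 1 ⊕ (varY ⊗ unit)))

theorem7p10 : ∃ λ (p : Poly2) →
    ∀ (φ ψ θ : Formula) → Monotone φ →
    (u : LJProof (φ ⇒' ψ ∨' θ)) →
    Σ ℕ λ k → Σ ℕ λ l → Σ (Circuit (suc k)) λ C → Σ (Circuit (suc l)) λ D →
    (suc k ≤ evalP p (steps u) (codeLength u)) ×
    (suc l ≤ evalP p (steps u) (codeLength u)) ×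
    IsPDI φ ψ θ ⟦ C ⟧ ⟦ D ⟧
theorem7p10 = sizePolynomial , λ φ ψ θ φ-monotone u → let open Interpolation φ-monotone u in
  size (computeInterpolant ψ) , size (computeInterpolant θ) ,
  outputLast (computeInterpolant ψ) , outputLast (computeInterpolant θ) ,
  circuit-size ψ , circuit-size θ , isPDI
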